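{- Let $\mathcal{K}$ be a permutational perfectly generalizable category (in the sense described in the context), and let $A,B$ be formulae of $\mathcal{L}_{\neg,\wedge,\vee}$. Then $A$ and $B$ are isomorphic in $\mathcal{K}$ if and only if $A\leftrightarrow B$ is a theorem of $\mathcal{S}_{\neg,\wedge,\vee}$.
   Context: $\mathcal{L}_{\neg,\wedge,\vee}$ is the propositional language generated from an infinite set of letters by $\neg,\wedge,\vee$; tautology means classical tautology, $\rightarrow,\leftrightarrow$ being material implication and equivalence. The formal system $\mathcal{S}_{\neg,\wedge,\vee}$ derives expressions $A\leftrightarrow B$ for $A,B$ in $\mathcal{L}_{\neg,\wedge,\vee}$; axioms: all instances of $A\leftrightarrow A$, $((A\wedge B)\wedge C)\leftrightarrow(A\wedge(B\wedge C))$, $((A\vee B)\vee C)\leftrightarrow(A\vee(B\vee C))$, $(A\wedge B)\leftrightarrow(B\wedge A)$, $(A\vee B)\leftrightarrow(B\vee A)$, $\neg\neg A\leftrightarrow A$, $\neg(A\wedge B)\leftrightarrow(\neg A\vee\neg B)$, $\neg(A\vee B)\leftrightarrow(\neg A\wedge\neg B)$; rules: from $A\leftrightarrow B$ infer $B\leftrightarrow A$; from $A\leftrightarrow B$, $B\leftrightarrow C$ infer $A\leftrightarrow C$; from $A\leftrightarrow B$, $C\leftrightarrow D$ infer $(A\wedge C)\leftrightarrow(B\wedge D)$ and $(A\vee C)\leftrightarrow(B\vee D)$; from $A\leftrightarrow B$ infer $\neg A\leftrightarrow\neg B$. $\mathcal{K}$ is a category whose objects are the formulae of $\mathcal{L}_{\neg,\wedge,\vee}$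 such that: (i) for every theorem $A\leftrightarrow B$ of $\mathcal{S}_{\neg,\wedge,\vee}$ there is an isomorphism $A\to B$ in $\mathcal{K}$; (ii) if $f:A\to B$ is an arrow of $\mathcal{K}$ then $A\rightarrow B$ is a tautology. For a formula $A$, $|A|$ is the number of letter occurrences in $A$. For $f:A\to B$, an occurrence $x$ in $A$ has $o(x)=n-1$ if it is the $n$-th letter occurrence from the left in $A$, and an occurrence $x$ in $B$ has $o(x)=|A|+n-1$ if it is the $n$-th from the left in $B$. Every arrow $f:A\to B$ of $\mathcal{K}$ comes with an equivalence relation $L_f$ on $\{0,\ldots,|A|+|B|-1\}$ with $(o(x),o(y))\in L_f$ only if $x,y$ are occurrences of the same letter; $L_f$ is perfect when this holds with "if and only if". $A,B$ are uniform instances of $A_1,B_1$ when obtained from them by the same letter-for-letter substitution. $f:A\to B$ is generalized to $f_1:A_1\to B_1$ when $A,B$ are uniform instances of $A_1,B_1$ and $L_f=L_{f_1}$. $\mathcal{K}$ is perfectly generalizable when every arrow can be generalized to an arrow of $\mathcal{K}$ with perfect linking relation. $\mathcal{K}$ is permutational when for every isomorphism $f:A\to B$, $L_f$ corresponds to a bijection between the letter occurrences of $A$ and those of $B$, and for the inverse $g$ of $f$, $L_g$ corresponds to the inverse bijection. -}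

module Defs where

open import Level using (Level; _⊔_) renaming (suc to lsuc)
open import Data.Nat using (ℕ; zero; suc; _+_; _<_)
open import Data.Bool using (Bool; true; false; not; _∧_; _∨_)
open import Data.List using (List; []; _∷_; _++_; length)
open import Data.Maybe using (Maybe; just; nothing)
open import Data.Fin using (Fin; toℕ)
open import Data.Product using (Σ; _×_; _,_; ∃; ∃-syntax)
open import Data.Sum using (_⊎_)
open import Function.Bundles using (_↔_; Inverse)
open import Relation.Binary.PropositionalEquality using (_≡_)
open import Relation.Binary.Core using (Rel)

infixr 6 _∧'_
infixr 5 _∨'_

data Formula : Set where
  letter : ℕ → Formula
  ¬'_    : Formula → Formula
  _∧'_   : Formula → Formula → Formula
  _∨'_   : Formula → Formula → Formula

eval : (ℕ → Bool) → Formula → Bool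
eval v (letter p) = v p
eval v (¬' A)     = not (eval v A)
eval v (A ∧' B)   = eval v A ∧ eval v B
eval v (A ∨' B)   = eval v A ∨ eval v B

ImpTautology : Formula → Formula → Set
ImpTautology A B = (v : ℕ → Bool) → eval v A ≡ true → eval v B ≡ true

data S⊢_↔_ : Formula → Formula → Set where
  ax-refl    : ∀ {A} → S⊢ A ↔ A
  ax-∧-assoc : ∀ {A B C} → S⊢ ((A ∧' B) ∧' C) ↔ (A ∧' (B ∧' C))
  ax-∨-assoc : ∀ {A B C} → S⊢ ((A ∨' B) ∨' C) ↔ (A ∨' (B ∨' C))
  ax-∧-comm  : ∀ {A B} → S⊢ (A ∧' B) ↔ (B ∧' A)
  ax-∨-comm  : ∀ {A B} → S⊢ (A ∨' B) ↔ (B ∨' A)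
  ax-¬¬      : ∀ {A} → S⊢ (¬' ¬' A) ↔ A
  ax-dm-∧    : ∀ {A B} → S⊢ (¬' (A ∧' B)) ↔ ((¬' A) ∨' (¬' B))
  ax-dm-∨    : ∀ {A B} → S⊢ (¬' (A ∨' B)) ↔ ((¬' A) ∧' (¬' B))
  r-sym      : ∀ {A B} → S⊢ A ↔ B → S⊢ B ↔ A
  r-trans    : ∀ {A B C} → S⊢ A ↔ B → S⊢ B ↔ C → S⊢ A ↔ C
  r-∧        : ∀ {A B C D} → S⊢ A ↔ B → S⊢ C ↔ D → S⊢ (A ∧' C) ↔ (B ∧' D)
  r-∨        : ∀ {A B C D} → S⊢ A ↔ B → S⊢ C ↔ D → S⊢ (A ∨' C) ↔ (B ∨' D)
  r-¬        : ∀ {A B} → S⊢ A ↔ B → S⊢ (¬' A) ↔ (¬' B)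

letters : Formula → List ℕ
letters (letter p) = p ∷ []
letters (¬' A)     = letters A
letters (A ∧' B)   = letters A ++ letters B
letters (A ∨' B)   = letters A ++ letters B

∣_∣ : Formula → ℕ
∣ A ∣ = length (letters A)

nth : List ℕ → ℕ → Maybe ℕ
nth []       _       = nothing
nth (x ∷ xs) zero    = just x
nth (x ∷ xs) (suc i) = nth xs i

-- the letter of the occurrence with index i (in the sense of o(x)) for
-- an arrow A → B: indices 0..|A|-1 are in A, |A|..|A|+|B|-1 in B
occ : Formula → Formula → ℕ → Maybe ℕ
occ A B i = nth (letters A ++ letters B) i

subst : (ℕ → ℕ) → Formula → Formula
subst σ (letter p) = letter (σ p)
subst σ (¬' A)     = ¬' (subst σ A)
subst σ (A ∧' B)   = subst σ A ∧' subst σ B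
subst σ (A ∨' B)   = subst σ A ∨' subst σ B

UniformInstances : Formula → Formula → Formula → Formula → Set
UniformInstances A B A₁ B₁ =
  Σ (ℕ → ℕ) λ σ → (subst σ A₁ ≡ A) × (subst σ B₁ ≡ B)

record IsEquivalenceOn {r : Level} (n : ℕ) (R : Rel ℕ r) : Set r where
  field
    bounded : ∀ {i j} → R i j → (i < n) × (j < n)
    refl    : ∀ {i} → i < n → R i i
    sym     : ∀ {i j} → R i j → R j i
    trans   : ∀ {i j k} → R i j → R j k → R i k

_≐_ : {r s : Level} → Rel ℕ r → Rel ℕ s → Set (r ⊔ s)
R ≐ S = ∀ i j → (R i j → S i j) × (S i j → R i j)

record KCategory (h e r : Level) : Set (lsuc (h ⊔ e ⊔ r)) where
  infixr 9 _∘_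
  infix  4 _≈_
  field
    Hom   : Formula → Formula → Set h
    _≈_   : ∀ {A B} → Hom A B → Hom A B → Set e
    ≈-refl  : ∀ {A B} {f : Hom A B} → f ≈ f
    ≈-sym   : ∀ {A B} {f g : Hom A B} → f ≈ g → g ≈ f
    ≈-trans : ∀ {A B} {f g k : Hom A B} → f ≈ g → g ≈ k → f ≈ k
    id    : ∀ {A} → Hom A A
    _∘_   : ∀ {A B C} → Hom B C → Hom A B → Hom A C
    ∘-resp-≈ : ∀ {A B C} {f f' : Hom B C} {g g' : Hom A B} →
               f ≈ f' → g ≈ g' → f ∘ g ≈ f' ∘ g'
    assoc : ∀ {A B C D} {f : Hom A B} {g : Hom B C} {k : Hom C D} →
            (k ∘ g) ∘ f ≈ k ∘ (g ∘ f)
    identityˡ : ∀ {A B} {f : Hom A B} → id ∘ f ≈ f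
    identityʳ : ∀ {A B} {f : Hom A B} → f ∘ id ≈ f

  IsInverseOf : ∀ {A B} → Hom B A → Hom A B → Set e
  IsInverseOf g f = (g ∘ f ≈ id) × (f ∘ g ≈ id)

  Isomorphic : Formula → Formula → Set (h ⊔ e)
  Isomorphic A B = Σ (Hom A B) λ f → Σ (Hom B A) λ g → IsInverseOf g f

  field
    L       : ∀ {A B} → Hom A B → Rel ℕ r
    L-equiv : ∀ {A B} (f : Hom A B) → IsEquivalenceOn (∣ A ∣ + ∣ B ∣) (L f)
    L-sound : ∀ {A B} (f : Hom A B) → ∀ {i j} → L f i j → occ A B i ≡ occ A B j
    cond-i  : ∀ {A B} → S⊢ A ↔ B → Isomorphic A B
    cond-ii : ∀ {A B} → Hom A B → ImpTautology A B

  Perfect : ∀ {A B} → Hom A B → Set r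
  Perfect {A} {B} f = ∀ i j → i < ∣ A ∣ + ∣ B ∣ → j < ∣ A ∣ + ∣ B ∣ →
                      occ A B i ≡ occ A B j → L f i j

  GeneralizedTo : ∀ {A B A₁ B₁} → Hom A B → Hom A₁ B₁ → Set r
  GeneralizedTo {A} {B} {A₁} {B₁} f f₁ =
    UniformInstances A B A₁ B₁ × (L f ≐ L f₁)

PerfectlyGeneralizable : ∀ {h e r} → KCategory h e r → Set (h ⊔ r)
PerfectlyGeneralizable K =
  ∀ {A B} (f : Hom A B) →
  Σ Formula λ A₁ → Σ Formula λ B₁ → Σ (Hom A₁ B₁) λ f₁ →
    GeneralizedTo f f₁ × Perfect f₁
  where open KCategory K

-- the relation on {0,…,m+n-1} corresponding to a map π from the
-- occurrences 0..m-1 to the occurrences m..m+n-1 (via k ↦ m + π k):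
-- its classes are the singletons {i} and the pairs {k, m + π k}
BijRel : (m n : ℕ) → (Fin m → Fin n) → Rel ℕ Level.zero
BijRel m n π i j =
  ((i ≡ j) × (i < m + n))
  ⊎ (Σ (Fin m) λ k → (i ≡ toℕ k) × (j ≡ m + toℕ (π k)))
  ⊎ (Σ (Fin m) λ k → (j ≡ toℕ k) × (i ≡ m + toℕ (π k)))

Permutational : ∀ {h e r} → KCategory h e r → Set (h ⊔ e ⊔ r)
Permutational K =
  ∀ {A B} (f : Hom A B) (g : Hom B A) → IsInverseOf g f →
  Σ (Fin ∣ A ∣ ↔ Fin ∣ B ∣) λ π →
    (L f ≐ BijRel ∣ A ∣ ∣ B ∣ (Inverse.to π))
    × (L g ≐ BijRel ∣ B ∣ ∣ A ∣ (Inverse.from π))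
  where open KCategory K

-- An isomorphism f : A → B with inverse g is linked, by permutationality, through a
-- bijection π between the letter occurrences of A and B, and by perfect generalizability
-- f generalizes to f₁ : A₁ → B₁ with the same linking, now perfect. A linking that is
-- both bijective and perfect forces A₁ and B₁ to be read-once (no letter occurs twice),
-- with π matching their letters. Generalizing g in the same way, the generalization of g
-- is, up to renaming letters, an arrow B₁ → A₁; by condition (ii) A₁ and B₁ are then
-- equivalent. It remains to show that S is complete for read-once formulas: equivalent
-- read-once formulas with the same letters are S-provably equivalent; substituting back
-- gives A ↔ B.
--
-- For the completeness we pass to negation normal form and induct on size. A read-once
-- disjunction admits no nontrivial splitting of its models along a set of letters, while a
-- conjunction does. This excludes comparing a conjunction with a disjunction, and in two
-- equivalent conjunctions it forces the conjuncts containing a given letter to have the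
-- same letters, hence to be equivalent, as are the remaining factors; the induction
-- hypothesis applies to both. Disjunctions are compared through their negations.

module Submission where

open import Defs
open import Level using (Level)
open import Data.Bool using (Bool; true; false; not; _∧_; _∨_)
open import Data.Bool.Properties
  using (∧-assoc; ∨-assoc; ∧-comm; ∨-comm; not-involutive; ∧-identityʳ; ∨-zeroʳ; ¬-not; ∨-∧-booleanAlgebra)
open import Algebra.Lattice.Properties.BooleanAlgebra ∨-∧-booleanAlgebra using (deMorgan₁; deMorgan₂)
open import Data.Empty using (⊥; ⊥-elim)
open import Data.Fin as Fin using (Fin; toℕ; fromℕ<)
open import Data.Fin.Properties using (toℕ<n; toℕ-fromℕ<)
open import Data.List using (List; []; _∷_; _++_; length; map)
open import Data.List.Properties
  using (++-assoc; length-++; length-map; map-++; map-cong-local; ∷-injective; ∷-injectiveˡ)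
open import Data.List.Membership.Propositional using (_∈_; _∉_)
open import Data.List.Membership.Propositional.Properties using (∈-++⁺ˡ; ∈-++⁺ʳ; ∈-++⁻)
open import Data.List.Relation.Binary.BagAndSetEquality using (_∼[_]_; set)
open import Data.List.Relation.Binary.Disjoint.Propositional using (Disjoint)
open import Data.List.Relation.Binary.Permutation.Propositional
  using (_↭_; ↭-refl; ↭-sym; ↭-trans; ↭-reflexive; ↭⇒↭ₛ)
open import Data.List.Relation.Binary.Permutation.Propositional.Properties
  using (↭-length; ++⁺; ∈-resp-↭) renaming (++-comm to ↭-++-comm)
open import Data.List.Relation.Binary.Subset.Propositional using (_⊆_)
import Data.List.Relation.Unary.All as All
open import Data.List.Relation.Unary.All.Properties using (++⁻ˡ; ++⁻ʳ)
open import Data.List.Relation.Unary.AllPairs using ([]; _∷_)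
open import Data.List.Relation.Unary.Any using (here; there)
open import Data.List.Relation.Unary.Unique.Propositional using (Unique)
open import Data.Maybe using (just)
import Data.Maybe as Maybe
open import Data.Maybe.Properties using (just-injective)
open import Data.Nat using (ℕ; zero; suc; _+_; _<_; _≤_; _≟_; s≤s; z≤n; s≤s⁻¹)
open import Data.List.Membership.DecPropositional _≟_ using (_∈?_)
open import Data.Nat.Properties
  using (+-cancelˡ-≡; suc-injective; m+n≮m; m<m+n; m<n+m; <-≤-trans; ≤-trans; ≤-refl; ≤-reflexive)
open import Data.Product using (Σ; ∃; _×_; _,_; proj₁; proj₂; swap)
open import Data.Sum using (_⊎_; inj₁; inj₂)
open import Function using (_∘_; id; case_of_)
open import Function.Bundles using (_⇔_; _↔_; mk⇔; Inverse; Equivalence)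
open import Relation.Binary.PropositionalEquality
  using (_≡_; _≢_; _≗_; refl; setoid; sym; trans; cong; cong₂; subst₂; module ≡-Reasoning)
  renaming (subst to transport)
open import Relation.Nullary using (¬_; yes; no)
open import Data.List.Relation.Binary.Permutation.Setoid.Properties (setoid ℕ) using (Unique-resp-↭)

open Equivalence using (to; from)

Valuation : Set
Valuation = ℕ → Bool

private
  variable
    A B C D X Y A₁ A₂ B₁ B₂ : Formula
    p q x : ℕ
    S : List ℕ
    v w : Valuation

infix 4 _≈ᵉ_
_≈ᵉ_ : Formula → Formula → Set
A ≈ᵉ B = ∀ v → eval v A ≡ eval v B

ReadOnce : Formula → Set
ReadOnce A = Unique (letters A)

SameLetters : Formula → Formula → Set
SameLetters A B = letters A ∼[ set ] letters B

S⊢-sound : S⊢ A ↔ B → A ≈ᵉ B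
S⊢-sound ax-refl                  v = refl
S⊢-sound (ax-∧-assoc {A} {B} {C}) v = ∧-assoc (eval v A) (eval v B) (eval v C)
S⊢-sound (ax-∨-assoc {A} {B} {C}) v = ∨-assoc (eval v A) (eval v B) (eval v C)
S⊢-sound (ax-∧-comm {A} {B})      v = ∧-comm (eval v A) (eval v B)
S⊢-sound (ax-∨-comm {A} {B})      v = ∨-comm (eval v A) (eval v B)
S⊢-sound (ax-¬¬ {A})              v = not-involutive (eval v A)
S⊢-sound (ax-dm-∧ {A} {B})        v = deMorgan₁ (eval v A) (eval v B)
S⊢-sound (ax-dm-∨ {A} {B})        v = deMorgan₂ (eval v A) (eval v B)
S⊢-sound (r-sym d)                v = sym (S⊢-sound d v)
S⊢-sound (r-trans d e)            v = trans (S⊢-sound d v) (S⊢-sound e v)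
S⊢-sound (r-∧ d e)                v = cong₂ _∧_ (S⊢-sound d v) (S⊢-sound e v)
S⊢-sound (r-∨ d e)                v = cong₂ _∨_ (S⊢-sound d v) (S⊢-sound e v)
S⊢-sound (r-¬ d)                  v = cong not (S⊢-sound d v)

S⊢-letters-↭ : S⊢ A ↔ B → letters A ↭ letters B
S⊢-letters-↭ ax-refl                  = ↭-refl
S⊢-letters-↭ (ax-∧-assoc {A} {B} {C}) = ↭-reflexive (++-assoc (letters A) (letters B) (letters C))
S⊢-letters-↭ (ax-∨-assoc {A} {B} {C}) = ↭-reflexive (++-assoc (letters A) (letters B) (letters C))
S⊢-letters-↭ (ax-∧-comm {A} {B})      = ↭-++-comm (letters A) (letters B)
S⊢-letters-↭ (ax-∨-comm {A} {B})      = ↭-++-comm (letters A) (letters B)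
S⊢-letters-↭ ax-¬¬                    = ↭-refl
S⊢-letters-↭ ax-dm-∧                  = ↭-refl
S⊢-letters-↭ ax-dm-∨                  = ↭-refl
S⊢-letters-↭ (r-sym d)                = ↭-sym (S⊢-letters-↭ d)
S⊢-letters-↭ (r-trans d e)            = ↭-trans (S⊢-letters-↭ d) (S⊢-letters-↭ e)
S⊢-letters-↭ (r-∧ d e)                = ++⁺ (S⊢-letters-↭ d) (S⊢-letters-↭ e)
S⊢-letters-↭ (r-∨ d e)                = ++⁺ (S⊢-letters-↭ d) (S⊢-letters-↭ e)
S⊢-letters-↭ (r-¬ d)                  = S⊢-letters-↭ d

S⊢-subst : ∀ σ → S⊢ A ↔ B → S⊢ subst σ A ↔ subst σ B
S⊢-subst σ ax-refl       = ax-refl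
S⊢-subst σ ax-∧-assoc    = ax-∧-assoc
S⊢-subst σ ax-∨-assoc    = ax-∨-assoc
S⊢-subst σ ax-∧-comm     = ax-∧-comm
S⊢-subst σ ax-∨-comm     = ax-∨-comm
S⊢-subst σ ax-¬¬         = ax-¬¬
S⊢-subst σ ax-dm-∧       = ax-dm-∧
S⊢-subst σ ax-dm-∨       = ax-dm-∨
S⊢-subst σ (r-sym d)     = r-sym (S⊢-subst σ d)
S⊢-subst σ (r-trans d e) = r-trans (S⊢-subst σ d) (S⊢-subst σ e)
S⊢-subst σ (r-∧ d e)     = r-∧ (S⊢-subst σ d) (S⊢-subst σ e)
S⊢-subst σ (r-∨ d e)     = r-∨ (S⊢-subst σ d) (S⊢-subst σ e)
S⊢-subst σ (r-¬ d)       = r-¬ (S⊢-subst σ d)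

ReadOnce-resp-S⊢ : S⊢ A ↔ B → ReadOnce A → ReadOnce B
ReadOnce-resp-S⊢ d = Unique-resp-↭ (↭⇒↭ₛ (S⊢-letters-↭ d))

Unique-++⁻ : ∀ (xs : List ℕ) {ys} → Unique (xs ++ ys) → Unique xs × Unique ys × Disjoint xs ys
Unique-++⁻ []       u          = [] , u , λ ()
Unique-++⁻ (x ∷ xs) (x∉ ∷ u) with Unique-++⁻ xs u
... | uxs , uys , disjoint = ++⁻ˡ xs x∉ ∷ uxs , uys , λ
  { (here refl , x∈ys) → All.lookup (++⁻ʳ xs x∉) x∈ys refl
  ; (there y∈xs , y∈ys) → disjoint (y∈xs , y∈ys) }

some-letter : ∀ A → ∃ λ p → p ∈ letters A
some-letter (letter p) = p , here refl
some-letter (¬' A)     = some-letter A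
some-letter (A ∧' B)   = let p , p∈A = some-letter A in p , ∈-++⁺ˡ p∈A
some-letter (A ∨' B)   = let p , p∈A = some-letter A in p , ∈-++⁺ˡ p∈A

merge : List ℕ → Valuation → Valuation → Valuation
merge S v w x with x ∈? S
... | yes _ = v x
... | no  _ = w x

merge-∈ : x ∈ S → merge S v w x ≡ v x
merge-∈ {x} {S} x∈S with x ∈? S
... | yes _   = refl
... | no  x∉S = ⊥-elim (x∉S x∈S)

merge-∉ : x ∉ S → merge S v w x ≡ w x
merge-∉ {x} {S} x∉S with x ∈? S
... | yes x∈S = ⊥-elim (x∉S x∈S)
... | no  _   = refl

merge-absorbˡ : ∀ S (u v w : Valuation) → merge S (merge S u v) w ≗ merge S u w
merge-absorbˡ S u v w x = case x ∈? S of λ where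
  (yes x∈S) → trans (merge-∈ x∈S) (trans (merge-∈ x∈S) (sym (merge-∈ x∈S)))
  (no  x∉S) → trans (merge-∉ x∉S) (sym (merge-∉ x∉S))

merge-absorbʳ : ∀ S (u v w : Valuation) → merge S u (merge S v w) ≗ merge S u w
merge-absorbʳ S u v w x = case x ∈? S of λ where
  (yes x∈S) → trans (merge-∈ x∈S) (sym (merge-∈ x∈S))
  (no  x∉S) → trans (merge-∉ x∉S) (trans (merge-∉ x∉S) (sym (merge-∉ x∉S)))

merge-agree-outside : (∀ {x} → x ∉ S → v x ≡ w x) → merge S v w ≗ v
merge-agree-outside {S} agree x = case x ∈? S of λ where
  (yes x∈S) → merge-∈ x∈S
  (no  x∉S) → trans (merge-∉ x∉S) (sym (agree x∉S))

merge-agree-inside : (∀ {x} → x ∈ S → v x ≡ w x) → merge S v w ≗ w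
merge-agree-inside {S} agree x = case x ∈? S of λ where
  (yes x∈S) → trans (merge-∈ x∈S) (agree x∈S)
  (no  x∉S) → merge-∉ x∉S

merge-cong-at : ∀ S {u u′ v v′ : Valuation} x → u x ≡ u′ x → v x ≡ v′ x → merge S u v x ≡ merge S u′ v′ x
merge-cong-at S x eu ev = case x ∈? S of λ where
  (yes x∈S) → trans (merge-∈ x∈S) (trans eu (sym (merge-∈ x∈S)))
  (no  x∉S) → trans (merge-∉ x∉S) (trans ev (sym (merge-∉ x∉S)))

merge-idem : ∀ S (v : Valuation) → merge S v v ≗ v
merge-idem S v x = case x ∈? S of λ where
  (yes x∈S) → merge-∈ x∈S
  (no  x∉S) → merge-∉ x∉S

merge-interchange : ∀ S T (u v w : Valuation) →
                    merge T (merge S u v) w ≗ merge S (merge T u w) (merge T v w)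
merge-interchange S T u v w x = case x ∈? T of λ where
  (yes x∈T) → trans (merge-∈ x∈T) (sym (merge-cong-at S x (merge-∈ x∈T) (merge-∈ x∈T)))
  (no  x∉T) → trans (merge-∉ x∉T)
                (sym (trans (merge-cong-at S x (merge-∉ x∉T) (merge-∉ x∉T)) (merge-idem S w x)))

toggle : ℕ → Valuation → Valuation
toggle p v x with x ≟ p
... | yes _ = not (v x)
... | no  _ = v x

toggle-≡ : ∀ p v → toggle p v p ≡ not (v p)
toggle-≡ p v with p ≟ p
... | yes _   = refl
... | no  p≢p = ⊥-elim (p≢p refl)

toggle-≢ : ∀ v → x ≢ p → toggle p v x ≡ v x
toggle-≢ {x} {p} v x≢p with x ≟ p
... | yes x≡p = ⊥-elim (x≢p x≡p)
... | no  _   = refl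

toggle-involutive : ∀ p (v : Valuation) → toggle p (toggle p v) ≗ v
toggle-involutive p v x = case x ≟ p of λ where
  (yes refl) → trans (toggle-≡ x (toggle x v)) (trans (cong not (toggle-≡ x v)) (not-involutive (v x)))
  (no  x≢p)  → trans (toggle-≢ (toggle p v) x≢p) (toggle-≢ v x≢p)

toggle-merge-∈ : p ∈ S → toggle p (merge S v w) ≗ merge S (toggle p v) w
toggle-merge-∈ {p} {S} {v} {w} p∈S x = case x ≟ p of λ where
  (yes refl) → trans (toggle-≡ x (merge S v w))
                 (trans (cong not (merge-∈ p∈S)) (sym (trans (merge-∈ p∈S) (toggle-≡ x v))))
  (no  x≢p)  → trans (toggle-≢ (merge S v w) x≢p) (merge-cong-at S x (sym (toggle-≢ v x≢p)) refl)

toggle-merge-∉ : p ∉ S → toggle p (merge S v w) ≗ merge S v (toggle p w)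
toggle-merge-∉ {p} {S} {v} {w} p∉S x = case x ≟ p of λ where
  (yes refl) → trans (toggle-≡ x (merge S v w))
                 (trans (cong not (merge-∉ p∉S)) (sym (trans (merge-∉ p∉S) (toggle-≡ x w))))
  (no  x≢p)  → trans (toggle-≢ (merge S v w) x≢p) (merge-cong-at S x refl (sym (toggle-≢ w x≢p)))

eval-cong : ∀ Z → (∀ {x} → x ∈ letters Z → v x ≡ w x) → eval v Z ≡ eval w Z
eval-cong (letter p) agree = agree (here refl)
eval-cong (¬' Z)     agree = cong not (eval-cong Z agree)
eval-cong (X ∧' Y)   agree =
  cong₂ _∧_ (eval-cong X (agree ∘ ∈-++⁺ˡ)) (eval-cong Y (agree ∘ ∈-++⁺ʳ (letters X)))
eval-cong (X ∨' Y)   agree =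
  cong₂ _∨_ (eval-cong X (agree ∘ ∈-++⁺ˡ)) (eval-cong Y (agree ∘ ∈-++⁺ʳ (letters X)))

eval-cong-≗ : ∀ Z → v ≗ w → eval v Z ≡ eval w Z
eval-cong-≗ Z v≗w = eval-cong Z (λ {x} _ → v≗w x)

eval-merge-⊆ : ∀ Z → letters Z ⊆ S → eval (merge S v w) Z ≡ eval v Z
eval-merge-⊆ Z Z⊆S = eval-cong Z (merge-∈ ∘ Z⊆S)

eval-merge-disjoint : ∀ Z → Disjoint (letters Z) S → eval (merge S v w) Z ≡ eval w Z
eval-merge-disjoint Z disjoint = eval-cong Z (λ x∈Z → merge-∉ (λ x∈S → disjoint (x∈Z , x∈S)))

eval-merge-∧ : ∀ X Y → letters X ⊆ S → Disjoint (letters Y) S →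
               eval (merge S v w) (X ∧' Y) ≡ eval v X ∧ eval w Y
eval-merge-∧ X Y X⊆S Y∩S = cong₂ _∧_ (eval-merge-⊆ X X⊆S) (eval-merge-disjoint Y Y∩S)

eval-toggle-∉ : ∀ Z → p ∉ letters Z → eval (toggle p v) Z ≡ eval v Z
eval-toggle-∉ {v = v} Z p∉Z = eval-cong Z (λ x∈Z → toggle-≢ v λ { refl → p∉Z x∈Z })

eval-subst : ∀ σ Z → eval v (subst σ Z) ≡ eval (v ∘ σ) Z
eval-subst σ (letter p) = refl
eval-subst σ (¬' Z)     = cong not (eval-subst σ Z)
eval-subst σ (X ∧' Y)   = cong₂ _∧_ (eval-subst σ X) (eval-subst σ Y)
eval-subst σ (X ∨' Y)   = cong₂ _∨_ (eval-subst σ X) (eval-subst σ Y)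

data NNF : Formula → Set where
  pos : ∀ p → NNF (letter p)
  neg : ∀ p → NNF (¬' letter p)
  and : NNF X → NNF Y → NNF (X ∧' Y)
  or  : NNF X → NNF Y → NNF (X ∨' Y)

signed : Bool → Formula → Formula
signed true  A = A
signed false A = ¬' A

nnf : Bool → Formula → Formula
nnf true  (letter p) = letter p
nnf false (letter p) = ¬' letter p
nnf true  (¬' A)     = nnf false A
nnf false (¬' A)     = nnf true A
nnf true  (A ∧' B)   = nnf true A ∧' nnf true B
nnf false (A ∧' B)   = nnf false A ∨' nnf false B
nnf true  (A ∨' B)   = nnf true A ∨' nnf true B
nnf false (A ∨' B)   = nnf false A ∧' nnf false B

nnf-NNF : ∀ b A → NNF (nnf b A)
nnf-NNF true  (letter p) = pos p
nnf-NNF false (letter p) = neg p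
nnf-NNF true  (¬' A)     = nnf-NNF false A
nnf-NNF false (¬' A)     = nnf-NNF true A
nnf-NNF true  (A ∧' B)   = and (nnf-NNF true A) (nnf-NNF true B)
nnf-NNF false (A ∧' B)   = or (nnf-NNF false A) (nnf-NNF false B)
nnf-NNF true  (A ∨' B)   = or (nnf-NNF true A) (nnf-NNF true B)
nnf-NNF false (A ∨' B)   = and (nnf-NNF false A) (nnf-NNF false B)

S⊢-nnf : ∀ b A → S⊢ signed b A ↔ nnf b A
S⊢-nnf true  (letter p) = ax-refl
S⊢-nnf false (letter p) = ax-refl
S⊢-nnf true  (¬' A)     = S⊢-nnf false A
S⊢-nnf false (¬' A)     = r-trans ax-¬¬ (S⊢-nnf true A)
S⊢-nnf true  (A ∧' B)   = r-∧ (S⊢-nnf true A) (S⊢-nnf true B)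
S⊢-nnf false (A ∧' B)   = r-trans ax-dm-∧ (r-∨ (S⊢-nnf false A) (S⊢-nnf false B))
S⊢-nnf true  (A ∨' B)   = r-∨ (S⊢-nnf true A) (S⊢-nnf true B)
S⊢-nnf false (A ∨' B)   = r-trans ax-dm-∨ (r-∧ (S⊢-nnf false A) (S⊢-nnf false B))

S⊢-from-nnf : ∀ b → S⊢ nnf b A ↔ nnf b B → S⊢ A ↔ B
S⊢-from-nnf {A} {B} true  d = r-trans (S⊢-nnf true A) (r-trans d (r-sym (S⊢-nnf true B)))
S⊢-from-nnf {A} {B} false d =
  r-trans (r-sym ax-¬¬)
          (r-trans (r-¬ (r-trans (S⊢-nnf false A) (r-trans d (r-sym (S⊢-nnf false B))))) ax-¬¬)

record ReadOnceEquivalent (A B : Formula) : Set where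
  field
    read-onceˡ   : ReadOnce A
    read-onceʳ   : ReadOnce B
    same-letters : SameLetters A B
    equivalent   : A ≈ᵉ B

open ReadOnceEquivalent

ReadOnceEquivalent-sym : ReadOnceEquivalent A B → ReadOnceEquivalent B A
ReadOnceEquivalent-sym e = record
  { read-onceˡ   = read-onceʳ e
  ; read-onceʳ   = read-onceˡ e
  ; same-letters = mk⇔ (from (same-letters e)) (to (same-letters e))
  ; equivalent   = sym ∘ equivalent e
  }

ReadOnceEquivalent-resp-S⊢ : S⊢ A ↔ A₁ → S⊢ B ↔ B₁ → ReadOnceEquivalent A B → ReadOnceEquivalent A₁ B₁
ReadOnceEquivalent-resp-S⊢ dA dB e = record
  { read-onceˡ   = ReadOnce-resp-S⊢ dA (read-onceˡ e)
  ; read-onceʳ   = ReadOnce-resp-S⊢ dB (read-onceʳ e)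
  ; same-letters = mk⇔ (∈-resp-↭ ↭B ∘ to (same-letters e) ∘ ∈-resp-↭ (↭-sym ↭A))
                       (∈-resp-↭ ↭A ∘ from (same-letters e) ∘ ∈-resp-↭ (↭-sym ↭B))
  ; equivalent   = λ v → trans (sym (S⊢-sound dA v)) (trans (equivalent e v) (S⊢-sound dB v))
  }
  where
  ↭A = S⊢-letters-↭ dA
  ↭B = S⊢-letters-↭ dB

ReadOnceEquivalent-nnf : ∀ b → ReadOnceEquivalent A B → ReadOnceEquivalent (nnf b A) (nnf b B)
ReadOnceEquivalent-nnf {A} {B} b e =
  ReadOnceEquivalent-resp-S⊢ (S⊢-nnf b A) (S⊢-nnf b B) (signed-equivalent b)
  where
  signed-equivalent : ∀ b → ReadOnceEquivalent (signed b A) (signed b B)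
  signed-equivalent true  = e
  signed-equivalent false = record
    { read-onceˡ = read-onceˡ e ; read-onceʳ = read-onceʳ e
    ; same-letters = same-letters e ; equivalent = cong not ∘ equivalent e }

true≢false : true ≢ false
true≢false ()

∧≡true⁻ : ∀ x {y} → x ∧ y ≡ true → x ≡ true × y ≡ true
∧≡true⁻ true y≡true = refl , y≡true

Essential : Formula → ℕ → Set
Essential Z p = Σ Valuation λ v → eval v Z ≡ true × eval (toggle p v) Z ≡ false

JointlyCritical : Formula → ℕ → ℕ → Set
JointlyCritical Z p q =
  Σ Valuation λ v → eval v Z ≡ true × eval (toggle p v) Z ≡ false × eval (toggle q v) Z ≡ false

-- Z splits along S when combining the S-part of one model with the rest of another gives a model,
-- i.e. Z is semantically a conjunction of a formula over S and one over the remaining letters.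
Splits : Formula → List ℕ → Set
Splits Z S = ∀ v w → eval v Z ≡ true → eval w Z ≡ true → eval (merge S v w) Z ≡ true

essential-resp : ∀ A B → A ≈ᵉ B → Essential A p → Essential B p
essential-resp _ _ A≈B (v , t , f) = v , trans (sym (A≈B v)) t , trans (sym (A≈B _)) f

essential-∧ˡ : ∀ X Y → Disjoint (letters X) (letters Y) → p ∈ letters X →
               Essential X p → (∃ λ w → eval w Y ≡ true) → Essential (X ∧' Y) p
essential-∧ˡ {p} X Y disjoint p∈X (v , t , f) (w , tw) =
  merge (letters X) v w , value v t , trans (eval-cong-≗ (X ∧' Y) (toggle-merge-∈ p∈X)) (value (toggle p v) f)
  where
  value : ∀ u {b} → eval u X ≡ b → eval (merge (letters X) u w) (X ∧' Y) ≡ b ∧ true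
  value u eq = trans (eval-merge-∧ X Y id (disjoint ∘ swap)) (cong₂ _∧_ eq tw)

essential-∨ˡ : ∀ X Y → Disjoint (letters X) (letters Y) → p ∈ letters X →
               Essential X p → (∃ λ w → eval w Y ≡ false) → Essential (X ∨' Y) p
essential-∨ˡ {p} X Y disjoint p∈X (v , t , f) (w , fw) =
  merge (letters X) v w , value v t , trans (eval-cong-≗ (X ∨' Y) (toggle-merge-∈ p∈X)) (value (toggle p v) f)
  where
  value : ∀ u {b} → eval u X ≡ b → eval (merge (letters X) u w) (X ∨' Y) ≡ b ∨ false
  value u eq = cong₂ _∨_ (trans (eval-merge-⊆ X id) eq) (trans (eval-merge-disjoint Y (disjoint ∘ swap)) fw)

mutual
  essential : ∀ Z → ReadOnce Z → p ∈ letters Z → Essential Z p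
  essential (letter q) _ (here refl) = (λ _ → true) , refl , toggle-≡ q _
  essential {p} (¬' Z) ro p∈Z =
    let v , t , f = essential Z ro p∈Z
    in toggle p v , cong not f , trans (cong not (eval-cong-≗ Z (toggle-involutive p v))) (cong not t)
  essential (X ∧' Y) ro p∈ with Unique-++⁻ (letters X) ro | ∈-++⁻ (letters X) p∈
  ... | roX , roY , disjoint | inj₁ p∈X =
    essential-∧ˡ X Y disjoint p∈X (essential X roX p∈X) (satisfiable Y roY)
  ... | roX , roY , disjoint | inj₂ p∈Y = essential-resp (Y ∧' X) (X ∧' Y) (S⊢-sound (ax-∧-comm {Y} {X}))
    (essential-∧ˡ Y X (disjoint ∘ swap) p∈Y (essential Y roY p∈Y) (satisfiable X roX))
  essential (X ∨' Y) ro p∈ with Unique-++⁻ (letters X) ro | ∈-++⁻ (letters X) p∈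
  ... | roX , roY , disjoint | inj₁ p∈X =
    essential-∨ˡ X Y disjoint p∈X (essential X roX p∈X) (falsifiable Y roY)
  ... | roX , roY , disjoint | inj₂ p∈Y = essential-resp (Y ∨' X) (X ∨' Y) (S⊢-sound (ax-∨-comm {Y} {X}))
    (essential-∨ˡ Y X (disjoint ∘ swap) p∈Y (essential Y roY p∈Y) (falsifiable X roX))

  satisfiable : ∀ Z → ReadOnce Z → ∃ λ v → eval v Z ≡ true
  satisfiable Z ro = let v , t , _ = essential Z ro (proj₂ (some-letter Z)) in v , t

  falsifiable : ∀ Z → ReadOnce Z → ∃ λ v → eval v Z ≡ false
  falsifiable Z ro = let p , p∈Z = some-letter Z ; v , _ , f = essential Z ro p∈Z in toggle p v , f

jointly-critical-sym : ∀ Z → JointlyCritical Z p q → JointlyCritical Z q p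
jointly-critical-sym _ (v , t , fp , fq) = v , t , fq , fp

∨-not-jointly-critical : ∀ C D → Disjoint (letters C) (letters D) → p ∈ letters C → q ∈ letters D →
                         ¬ JointlyCritical (C ∨' D) p q
∨-not-jointly-critical {p} {q} C D disjoint p∈C q∈D (v , t , fp , fq) with eval v C in C-value
... | true  = true≢false (trans (sym (cong (_∨ eval (toggle q v) D) C-still-true)) fq)
  where
  C-still-true : eval (toggle q v) C ≡ true
  C-still-true = trans (eval-toggle-∉ C (λ q∈C → disjoint (q∈C , q∈D))) C-value
... | false = true≢false (trans (sym (trans (cong (eval (toggle p v) C ∨_) D-still-true) (∨-zeroʳ _))) fp)
  where
  D-still-true : eval (toggle p v) D ≡ true
  D-still-true = trans (eval-toggle-∉ D (λ p∈D → disjoint (p∈C , p∈D))) t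

splits⇒jointly-critical : ∀ Z → ReadOnce Z → Splits Z S → p ∈ letters Z → q ∈ letters Z →
                          p ∈ S → q ∉ S → JointlyCritical Z p q
splits⇒jointly-critical {S} {p} {q} Z ro split p∈Z q∈Z p∈S q∉S
  with essential Z ro p∈Z | essential Z ro q∈Z
... | v , vt , vf | w , wt , wf = merge S v w , split v w vt wt , p-critical , q-critical
  where
  open ≡-Reasoning
  p-critical : eval (toggle p (merge S v w)) Z ≡ false
  p-critical = ¬-not λ t → true≢false (trans (sym (begin
    eval (toggle p v) Z
      ≡⟨ eval-cong-≗ Z (λ x → sym (trans (merge-absorbˡ S (toggle p v) w v x)
           (merge-agree-outside (λ {y} y∉S → toggle-≢ {y} {p} v λ { refl → y∉S p∈S }) x))) ⟩
    eval (merge S (merge S (toggle p v) w) v) Z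
      ≡⟨ split _ _ (trans (sym (eval-cong-≗ Z (toggle-merge-∈ p∈S))) t) vt ⟩
    true ∎)) vf)
  q-critical : eval (toggle q (merge S v w)) Z ≡ false
  q-critical = ¬-not λ t → true≢false (trans (sym (begin
    eval (toggle q w) Z
      ≡⟨ eval-cong-≗ Z (λ x → sym (trans (merge-absorbʳ S w v (toggle q w) x)
           (merge-agree-inside (λ {y} y∈S → sym (toggle-≢ {y} {q} w λ { refl → q∉S y∈S })) x))) ⟩
    eval (merge S w (merge S v (toggle q w))) Z
      ≡⟨ split _ _ wt (trans (sym (eval-cong-≗ Z (toggle-merge-∉ q∉S))) t) ⟩
    true ∎)) wf)

splits-resp : ∀ A B → A ≈ᵉ B → Splits A S → Splits B S
splits-resp _ _ A≈B split v w vt wt =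
  trans (sym (A≈B _)) (split v w (trans (A≈B v) vt) (trans (A≈B w) wt))

∧-splits : ∀ X Y → Disjoint (letters X) (letters Y) → Splits (X ∧' Y) (letters X)
∧-splits X Y disjoint v w vt wt =
  trans (eval-merge-∧ X Y id (disjoint ∘ swap))
        (cong₂ _∧_ (proj₁ (∧≡true⁻ (eval v X) vt)) (proj₂ (∧≡true⁻ (eval w X) wt)))

splits-restrict : ∀ A B T α → (∀ v → eval v A ≡ eval (merge T v α) B) → Splits B S → Splits A S
splits-restrict {S} A B T α restrict split v w vt wt = begin
  eval (merge S v w) A                          ≡⟨ restrict _ ⟩
  eval (merge T (merge S v w) α) B              ≡⟨ eval-cong-≗ B (merge-interchange S T v w α) ⟩
  eval (merge S (merge T v α) (merge T w α)) B  ≡⟨ split _ _ (trans (sym (restrict v)) vt)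
                                                               (trans (sym (restrict w)) wt) ⟩
  true                                          ∎
  where open ≡-Reasoning

Separates : List ℕ → ℕ → ℕ → Set
Separates S x y = (x ∈ S × y ∉ S) ⊎ (y ∈ S × x ∉ S)

separating-pair : ∀ (xs ys : List ℕ) → ∃ (_∈ xs) → ∃ (_∈ ys) → p ∈ xs ++ ys → q ∈ xs ++ ys →
                  p ∈ S → q ∉ S → Σ ℕ λ x → Σ ℕ λ y → x ∈ xs × y ∈ ys × Separates S x y
separating-pair {p} {q} {S} xs ys (x₀ , x₀∈xs) (y₀ , y₀∈ys) p∈ q∈ p∈S q∉S
  with ∈-++⁻ xs p∈ | ∈-++⁻ xs q∈
... | inj₁ p∈xs | inj₂ q∈ys = p , q , p∈xs , q∈ys , inj₁ (p∈S , q∉S)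
... | inj₂ p∈ys | inj₁ q∈xs = q , p , q∈xs , p∈ys , inj₂ (p∈S , q∉S)
... | inj₁ p∈xs | inj₁ q∈xs with y₀ ∈? S
...   | yes y₀∈S = q , y₀ , q∈xs , y₀∈ys , inj₂ (y₀∈S , q∉S)
...   | no  y₀∉S = p , y₀ , p∈xs , y₀∈ys , inj₁ (p∈S , y₀∉S)
separating-pair {p} {q} {S} xs ys (x₀ , x₀∈xs) (y₀ , y₀∈ys) p∈ q∈ p∈S q∉S
    | inj₂ p∈ys | inj₂ q∈ys with x₀ ∈? S
...   | yes x₀∈S = x₀ , q , x₀∈xs , q∈ys , inj₁ (x₀∈S , q∉S)
...   | no  x₀∉S = x₀ , p , x₀∈xs , p∈ys , inj₂ (p∈S , x₀∉S)

∨-splits-trivially : ∀ C D → ReadOnce (C ∨' D) → Splits (C ∨' D) S →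
                     p ∈ letters (C ∨' D) → q ∈ letters (C ∨' D) → p ∈ S → q ∉ S → ⊥
∨-splits-trivially C D ro split p∈ q∈ p∈S q∉S
  with proj₂ (proj₂ (Unique-++⁻ (letters C) ro))
     | separating-pair (letters C) (letters D) (some-letter C) (some-letter D) p∈ q∈ p∈S q∉S
... | disjoint | c , d , c∈C , d∈D , inj₁ (c∈S , d∉S) =
  ∨-not-jointly-critical C D disjoint c∈C d∈D
    (splits⇒jointly-critical (C ∨' D) ro split (∈-++⁺ˡ c∈C) (∈-++⁺ʳ (letters C) d∈D) c∈S d∉S)
... | disjoint | c , d , c∈C , d∈D , inj₂ (d∈S , c∉S) =
  ∨-not-jointly-critical C D disjoint c∈C d∈D (jointly-critical-sym (C ∨' D)
    (splits⇒jointly-critical (C ∨' D) ro split (∈-++⁺ʳ (letters C) d∈D) (∈-++⁺ˡ c∈C) d∈S c∉S))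

∧≉∨ : ∀ X Y C D → ¬ ReadOnceEquivalent (X ∧' Y) (C ∨' D)
∧≉∨ X Y C D e with some-letter X | some-letter Y | proj₂ (proj₂ (Unique-++⁻ (letters X) (read-onceˡ e)))
... | p , p∈X | q , q∈Y | disjoint =
  ∨-splits-trivially {S = letters X} C D (read-onceʳ e)
    (splits-resp {S = letters X} (X ∧' Y) (C ∨' D) (equivalent e) (∧-splits X Y disjoint))
    (to (same-letters e) (∈-++⁺ˡ p∈X)) (to (same-letters e) (∈-++⁺ʳ (letters X) q∈Y))
    p∈X (λ q∈X → disjoint (q∈X , q∈Y))

-- Completeness of S for read-once formulas

data Conjunct : Formula → Set where
  pos : ∀ p → Conjunct (letter p)
  neg : ∀ p → Conjunct (¬' letter p)
  or  : NNF X → NNF Y → Conjunct (X ∨' Y)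

conjunct-NNF : Conjunct A → NNF A
conjunct-NNF (pos p)  = pos p
conjunct-NNF (neg p)  = neg p
conjunct-NNF (or a b) = or a b

conjunct-⊆ : Conjunct A → ReadOnce A → Splits A S → p ∈ letters A → p ∈ S → letters A ⊆ S
conjunct-⊆ (pos _) _ _ (here refl) p∈S (here refl) = p∈S
conjunct-⊆ (neg _) _ _ (here refl) p∈S (here refl) = p∈S
conjunct-⊆ {S = S} (or {C} {D} _ _) ro split p∈ p∈S {q} q∈ with q ∈? S
... | yes q∈S = q∈S
... | no  q∉S = ⊥-elim (∨-splits-trivially C D ro split p∈ q∈ p∈S q∉S)

record ConjunctOf (Z : Formula) (p : ℕ) : Set where
  constructor conjunctOf
  field
    conjunct rest : Formula
    is-conjunct   : Conjunct conjunct
    rest-NNF      : NNF rest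
    p∈conjunct    : p ∈ letters conjunct
    factorisation : S⊢ Z ↔ (conjunct ∧' rest)

mutual
  extract-conjunct : NNF X → NNF Y → p ∈ letters (X ∧' Y) → ConjunctOf (X ∧' Y) p
  extract-conjunct {X} nX nY p∈ with ∈-++⁻ (letters X) p∈
  ... | inj₁ p∈X = extract-conjunctˡ nX nY p∈X
  ... | inj₂ p∈Y = let conjunctOf c r nc nr p∈c d = extract-conjunctˡ nY nX p∈Y
                   in conjunctOf c r nc nr p∈c (r-trans ax-∧-comm d)

  extract-conjunctˡ : NNF X → NNF Y → p ∈ letters X → ConjunctOf (X ∧' Y) p
  extract-conjunctˡ (pos q)   nY p∈ = conjunctOf _ _ (pos q) nY p∈ ax-refl
  extract-conjunctˡ (neg q)   nY p∈ = conjunctOf _ _ (neg q) nY p∈ ax-refl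
  extract-conjunctˡ (or a b)  nY p∈ = conjunctOf _ _ (or a b) nY p∈ ax-refl
  extract-conjunctˡ (and a b) nY p∈ =
    let conjunctOf c r nc nr p∈c d = extract-conjunct a b p∈
    in conjunctOf c (r ∧' _) nc (and nr nY) p∈c (r-trans (r-∧ d ax-refl) ax-∧-assoc)

⊆-++-cancelˡ : ∀ {xs ys xs′ ys′ : List ℕ} → Disjoint xs ys → xs′ ⊆ xs → ys ⊆ xs′ ++ ys′ → ys ⊆ ys′
⊆-++-cancelˡ {xs′ = xs′} disjoint xs′⊆xs ys⊆ y∈ys with ∈-++⁻ xs′ (ys⊆ y∈ys)
... | inj₁ y∈xs′ = ⊥-elim (disjoint (xs′⊆xs y∈xs′ , y∈ys))
... | inj₂ y∈ys′ = y∈ys′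

eval-first-factor : ∀ X Y (α : Valuation) → Disjoint (letters X) (letters Y) → eval α Y ≡ true →
                    ∀ v → eval v X ≡ eval (merge (letters X) v α) (X ∧' Y)
eval-first-factor X Y α disjoint αY v = begin
  eval v X                               ≡⟨ ∧-identityʳ _ ⟨
  eval v X ∧ true                        ≡⟨ cong (eval v X ∧_) αY ⟨
  eval v X ∧ eval α Y                    ≡⟨ eval-merge-∧ X Y id (disjoint ∘ swap) ⟨
  eval (merge (letters X) v α) (X ∧' Y)  ∎
  where open ≡-Reasoning

-- A₁ agrees with B₁ ∧ B₂ once the letters outside A₁ are frozen at a model, so it inherits the
-- splitting of B₁ ∧ B₂ along the letters of B₁; a conjunct that splits along a set it meets lies inside it.
conjunct-letters-⊆ : Conjunct A₁ → p ∈ letters A₁ → p ∈ letters B₁ →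
                     ReadOnceEquivalent (A₁ ∧' A₂) (B₁ ∧' B₂) → letters A₁ ⊆ letters B₁
conjunct-letters-⊆ {A₁} {p} {B₁} {A₂} {B₂} cA p∈A₁ p∈B₁ e
  with Unique-++⁻ (letters A₁) (read-onceˡ e) | satisfiable (A₁ ∧' A₂) (read-onceˡ e)
... | roA₁ , _ , disjA | α , αA =
  conjunct-⊆ cA roA₁ (splits-restrict {S = letters B₁} A₁ (B₁ ∧' B₂) (letters A₁) α restrict B-splits)
    p∈A₁ p∈B₁
  where
  B-splits : Splits (B₁ ∧' B₂) (letters B₁)
  B-splits = ∧-splits B₁ B₂ (proj₂ (proj₂ (Unique-++⁻ (letters B₁) (read-onceʳ e))))
  restrict : ∀ v → eval v A₁ ≡ eval (merge (letters A₁) v α) (B₁ ∧' B₂)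
  restrict v = trans (eval-first-factor A₁ A₂ α disjA (proj₂ (∧≡true⁻ (eval α A₁) αA)) v) (equivalent e _)

∧-factors : SameLetters A₁ B₁ → ReadOnceEquivalent (A₁ ∧' A₂) (B₁ ∧' B₂) →
            ReadOnceEquivalent A₁ B₁ × ReadOnceEquivalent A₂ B₂
∧-factors {A₁} {B₁} {A₂} {B₂} same e
  with Unique-++⁻ (letters A₁) (read-onceˡ e) | Unique-++⁻ (letters B₁) (read-onceʳ e)
     | satisfiable (A₁ ∧' A₂) (read-onceˡ e)
... | roA₁ , roA₂ , disjA | roB₁ , roB₂ , disjB | α , αA =
  record { read-onceˡ = roA₁ ; read-onceʳ = roB₁ ; same-letters = same ; equivalent = first } ,
  record { read-onceˡ = roA₂ ; read-onceʳ = roB₂ ; same-letters = mk⇔ A₂⊆B₂ B₂⊆A₂ ; equivalent = second }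
  where
  open ≡-Reasoning
  αB = trans (sym (equivalent e α)) αA
  A₂⊆B₂ : letters A₂ ⊆ letters B₂
  A₂⊆B₂ = ⊆-++-cancelˡ disjA (from same) (to (same-letters e) ∘ ∈-++⁺ʳ (letters A₁))
  B₂⊆A₂ : letters B₂ ⊆ letters A₂
  B₂⊆A₂ = ⊆-++-cancelˡ disjB (to same) (from (same-letters e) ∘ ∈-++⁺ʳ (letters B₁))
  B₂∩A₁ : Disjoint (letters B₂) (letters A₁)
  B₂∩A₁ (x∈B₂ , x∈A₁) = disjB (to same x∈A₁ , x∈B₂)
  first : A₁ ≈ᵉ B₁
  first v = begin
    eval v A₁                                 ≡⟨ eval-first-factor A₁ A₂ α disjA (proj₂ (∧≡true⁻ _ αA)) v ⟩
    eval (merge (letters A₁) v α) (A₁ ∧' A₂)  ≡⟨ equivalent e _ ⟩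
    eval (merge (letters A₁) v α) (B₁ ∧' B₂)  ≡⟨ eval-merge-∧ B₁ B₂ (from same) B₂∩A₁ ⟩
    eval v B₁ ∧ eval α B₂                     ≡⟨ cong (eval v B₁ ∧_) (proj₂ (∧≡true⁻ _ αB)) ⟩
    eval v B₁ ∧ true                          ≡⟨ ∧-identityʳ _ ⟩
    eval v B₁                                 ∎
  second : A₂ ≈ᵉ B₂
  second v = begin
    eval v A₂                                 ≡⟨ cong (_∧ eval v A₂) (proj₁ (∧≡true⁻ _ αA)) ⟨
    eval α A₁ ∧ eval v A₂                     ≡⟨ eval-merge-∧ A₁ A₂ id (disjA ∘ swap) ⟨
    eval (merge (letters A₁) α v) (A₁ ∧' A₂)  ≡⟨ equivalent e _ ⟩
    eval (merge (letters A₁) α v) (B₁ ∧' B₂)  ≡⟨ eval-merge-∧ B₁ B₂ (from same) B₂∩A₁ ⟩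
    eval α B₁ ∧ eval v B₂                     ≡⟨ cong (_∧ eval v B₂) (proj₁ (∧≡true⁻ _ αB)) ⟩
    eval v B₂                                 ∎

Complete : ℕ → Set
Complete n = ∀ {A B} → ∣ A ∣ < n → NNF A → NNF B → ReadOnceEquivalent A B → S⊢ A ↔ B

∈⇒length-pos : ∀ {xs : List ℕ} → p ∈ xs → 0 < length xs
∈⇒length-pos (here _)  = s≤s z≤n
∈⇒length-pos (there _) = s≤s z≤n

first-factor-< : ∀ A B → ∣ A ∣ < ∣ A ∧' B ∣
first-factor-< A B = <-≤-trans (m<m+n ∣ A ∣ (∈⇒length-pos (proj₂ (some-letter B))))
                               (≤-reflexive (sym (length-++ (letters A))))

second-factor-< : ∀ A B → ∣ B ∣ < ∣ A ∧' B ∣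
second-factor-< A B = <-≤-trans (m<n+m ∣ B ∣ (∈⇒length-pos (proj₂ (some-letter A))))
                                (≤-reflexive (sym (length-++ (letters A))))

∧-complete : ∀ {n X Y X′ Y′} → Complete n → NNF X → NNF Y → NNF X′ → NNF Y′ → ∣ X ∧' Y ∣ ≤ n →
             ReadOnceEquivalent (X ∧' Y) (X′ ∧' Y′) → S⊢ (X ∧' Y) ↔ (X′ ∧' Y′)
∧-complete {X = X} complete nX nY nX′ nY′ size e with some-letter X
... | p , p∈X
  with extract-conjunct nX nY (∈-++⁺ˡ p∈X) | extract-conjunct nX′ nY′ (to (same-letters e) (∈-++⁺ˡ p∈X))
... | conjunctOf A₁ A₂ cA nA₂ p∈A₁ dA | conjunctOf B₁ B₂ cB nB₂ p∈B₁ dB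
  with ReadOnceEquivalent-resp-S⊢ dA dB e
... | e′ with ∧-factors (mk⇔ (conjunct-letters-⊆ cA p∈A₁ p∈B₁ e′)
                             (conjunct-letters-⊆ cB p∈B₁ p∈A₁ (ReadOnceEquivalent-sym e′))) e′
... | e₁ , e₂ = r-trans dA (r-trans (r-∧ first second) (r-sym dB))
  where
  size₁₂ : ∣ A₁ ∧' A₂ ∣ ≤ _
  size₁₂ = ≤-trans (≤-reflexive (sym (↭-length (S⊢-letters-↭ dA)))) size
  first  = complete (<-≤-trans (first-factor-< A₁ A₂) size₁₂) (conjunct-NNF cA) (conjunct-NNF cB) e₁
  second = complete (<-≤-trans (second-factor-< A₁ A₂) size₁₂) nA₂ nB₂ e₂

compound-not-single-letter : ∀ X Y → ReadOnce (X ∧' Y) → ¬ (letters (X ∧' Y) ⊆ p ∷ [])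
compound-not-single-letter X Y ro ⊆p with some-letter X | some-letter Y
... | x , x∈X | y , y∈Y with ⊆p (∈-++⁺ˡ x∈X) | ⊆p (∈-++⁺ʳ (letters X) y∈Y)
... | here refl | here refl = proj₂ (proj₂ (Unique-++⁻ (letters X) ro)) (x∈X , y∈Y)

nnf-complete : ∀ n → Complete n
nnf-complete zero    ()
nnf-complete (suc n) _ (pos p) (pos q) e with to (same-letters e) (here refl)
... | here refl = ax-refl
nnf-complete (suc n) _ (neg p) (neg q) e with to (same-letters e) (here refl)
... | here refl = ax-refl
nnf-complete (suc n) _ (pos p) (neg q) e = ⊥-elim (true≢false (equivalent e (λ _ → true)))
nnf-complete (suc n) _ (neg p) (pos q) e = ⊥-elim (true≢false (sym (equivalent e (λ _ → true))))
nnf-complete (suc n) _ (pos p) (and {X} {Y} _ _) e =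
  ⊥-elim (compound-not-single-letter X Y (read-onceʳ e) (from (same-letters e)))
nnf-complete (suc n) _ (pos p) (or {X} {Y} _ _) e =
  ⊥-elim (compound-not-single-letter X Y (read-onceʳ e) (from (same-letters e)))
nnf-complete (suc n) _ (neg p) (and {X} {Y} _ _) e =
  ⊥-elim (compound-not-single-letter X Y (read-onceʳ e) (from (same-letters e)))
nnf-complete (suc n) _ (neg p) (or {X} {Y} _ _) e =
  ⊥-elim (compound-not-single-letter X Y (read-onceʳ e) (from (same-letters e)))
nnf-complete (suc n) _ (and {X} {Y} _ _) (pos q) e =
  ⊥-elim (compound-not-single-letter X Y (read-onceˡ e) (to (same-letters e)))
nnf-complete (suc n) _ (and {X} {Y} _ _) (neg q) e =
  ⊥-elim (compound-not-single-letter X Y (read-onceˡ e) (to (same-letters e)))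
nnf-complete (suc n) _ (or {X} {Y} _ _) (pos q) e =
  ⊥-elim (compound-not-single-letter X Y (read-onceˡ e) (to (same-letters e)))
nnf-complete (suc n) _ (or {X} {Y} _ _) (neg q) e =
  ⊥-elim (compound-not-single-letter X Y (read-onceˡ e) (to (same-letters e)))
nnf-complete (suc n) size (and a b) (and c d) e = ∧-complete (nnf-complete n) a b c d (s≤s⁻¹ size) e
nnf-complete (suc n) _ (and {X} {Y} _ _) (or {C} {D} _ _) e = ⊥-elim (∧≉∨ X Y C D e)
nnf-complete (suc n) _ (or {C} {D} _ _) (and {X} {Y} _ _) e = ⊥-elim (∧≉∨ X Y C D (ReadOnceEquivalent-sym e))
nnf-complete (suc n) size (or {X} {Y} _ _) (or {X′} {Y′} _ _) e =
  S⊢-from-nnf false (∧-complete (nnf-complete n)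
    (nnf-NNF false X) (nnf-NNF false Y) (nnf-NNF false X′) (nnf-NNF false Y′)
    (≤-trans (≤-reflexive (sym (↭-length (S⊢-letters-↭ (S⊢-nnf false (X ∨' Y)))))) (s≤s⁻¹ size))
    (ReadOnceEquivalent-nnf false e))

read-once-complete : ReadOnceEquivalent A B → S⊢ A ↔ B
read-once-complete {A} {B} e =
  S⊢-from-nnf true (nnf-complete (suc ∣ nnf true A ∣) ≤-refl (nnf-NNF true A) (nnf-NNF true B)
                                 (ReadOnceEquivalent-nnf true e))

nth-++ˡ : ∀ (xs : List ℕ) {ys i} → i < length xs → nth (xs ++ ys) i ≡ nth xs i
nth-++ˡ (x ∷ xs) {i = zero}  _         = refl
nth-++ˡ (x ∷ xs) {i = suc i} (s≤s i<) = nth-++ˡ xs i<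

nth-++ʳ : ∀ (xs : List ℕ) {ys} k → nth (xs ++ ys) (length xs + k) ≡ nth ys k
nth-++ʳ []       k = refl
nth-++ʳ (x ∷ xs) k = nth-++ʳ xs k

nth-just⇒< : ∀ (xs : List ℕ) {i x} → nth xs i ≡ just x → i < length xs
nth-just⇒< (y ∷ xs) {zero}  _ = s≤s z≤n
nth-just⇒< (y ∷ xs) {suc i} e = s≤s (nth-just⇒< xs e)

nth⇒∈ : ∀ (xs : List ℕ) {i x} → nth xs i ≡ just x → x ∈ xs
nth⇒∈ (y ∷ xs) {zero}  refl = here refl
nth⇒∈ (y ∷ xs) {suc i} e    = there (nth⇒∈ xs e)

∈⇒nth : ∀ {xs : List ℕ} → x ∈ xs → ∃ λ i → nth xs i ≡ just x
∈⇒nth (here refl) = 0 , refl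
∈⇒nth (there x∈)  = let i , e = ∈⇒nth x∈ in suc i , e

nth-map : ∀ (f : ℕ → ℕ) xs i → nth (map f xs) i ≡ Maybe.map f (nth xs i)
nth-map f []       i       = refl
nth-map f (x ∷ xs) zero    = refl
nth-map f (x ∷ xs) (suc i) = nth-map f xs i

nth-index : ∀ {m} (xs : List ℕ) {i} → length xs ≡ m → nth xs i ≡ just x →
            Σ (Fin m) λ k → nth xs (toℕ k) ≡ just x
nth-index xs len e =
  fromℕ< (transport (_ <_) len (nth-just⇒< xs e)) , trans (cong (nth xs) (toℕ-fromℕ< _)) e

nth-injective⇒Unique : ∀ (xs : List ℕ) → (∀ {i j x} → nth xs i ≡ just x → nth xs j ≡ just x → i ≡ j) →
                       Unique xs
nth-injective⇒Unique []       _   = []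
nth-injective⇒Unique (x ∷ xs) inj =
  All.tabulate x≢ ∷ nth-injective⇒Unique xs (λ eᵢ eⱼ → suc-injective (inj eᵢ eⱼ))
  where
  x≢ : ∀ {y} → y ∈ xs → x ≢ y
  x≢ y∈xs refl with ∈⇒nth y∈xs
  ... | j , e with inj {0} {suc j} refl e
  ... | ()

nth-ext : ∀ {m} (xs ys : List ℕ) → length xs ≡ m → length ys ≡ m →
          (∀ (k : Fin m) → nth xs (toℕ k) ≡ nth ys (toℕ k)) → xs ≡ ys
nth-ext []       []       _    _    _ = refl
nth-ext []       (y ∷ ys) refl ()
nth-ext (x ∷ xs) []       refl ()
nth-ext (x ∷ xs) (y ∷ ys) refl ys≡ h =
  cong₂ _∷_ (just-injective (h Fin.zero)) (nth-ext xs ys refl (suc-injective ys≡) (h ∘ Fin.suc))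

Unique⇒map-onto : ∀ {xs ys : List ℕ} → Unique xs → length xs ≡ length ys → ∃ λ ρ → map ρ xs ≡ ys
Unique⇒map-onto {[]}     {[]}     _          _   = id , refl
Unique⇒map-onto {x ∷ xs} {y ∷ ys} (x∉xs ∷ u) len with Unique⇒map-onto u (suc-injective len)
... | ρ , ρxs = ρ′ , cong₂ _∷_ ρ′x (trans (map-cong-local (All.map ρ′≡ρ x∉xs)) ρxs)
  where
  ρ′ : ℕ → ℕ
  ρ′ z with z ≟ x
  ... | yes _ = y
  ... | no  _ = ρ z
  ρ′x : ρ′ x ≡ y
  ρ′x with x ≟ x
  ... | yes _   = refl
  ... | no  x≢x = ⊥-elim (x≢x refl)
  ρ′≡ρ : ∀ {z} → x ≢ z → ρ′ z ≡ ρ z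
  ρ′≡ρ {z} x≢z with z ≟ x
  ... | yes z≡x = ⊥-elim (x≢z (sym z≡x))
  ... | no  _   = refl

Relabels : ∀ {m n} → (Fin m → Fin n) → List ℕ → List ℕ → Set
Relabels π xs ys = ∀ k → nth ys (toℕ (π k)) ≡ nth xs (toℕ k)

BijRel-within-left : ∀ {m n} {π : Fin m → Fin n} {i j} → BijRel m n π i j → i < m → j < m → i ≡ j
BijRel-within-left     (inj₁ (i≡j , _))              _   _   = i≡j
BijRel-within-left {m} (inj₂ (inj₁ (_ , _ , refl))) _   j<m = ⊥-elim (m+n≮m m _ j<m)
BijRel-within-left {m} (inj₂ (inj₂ (_ , _ , refl))) i<m _   = ⊥-elim (m+n≮m m _ i<m)

BijRel-within-right : ∀ {m n} {π : Fin m → Fin n} {i j} → BijRel m n π (m + i) (m + j) → i ≡ j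
BijRel-within-right {m} (inj₁ (eq , _))              = +-cancelˡ-≡ m _ _ eq
BijRel-within-right {m} (inj₂ (inj₁ (k , eq , _))) = ⊥-elim (m+n≮m m _ (transport (_< m) (sym eq) (toℕ<n k)))
BijRel-within-right {m} (inj₂ (inj₂ (k , eq , _))) = ⊥-elim (m+n≮m m _ (transport (_< m) (sym eq) (toℕ<n k)))

bijective-perfect-linking :
  ∀ {m n} (π : Fin m → Fin n) (xs ys : List ℕ) → length xs ≡ m →
  (∀ {i j} → BijRel m n π i j → nth (xs ++ ys) i ≡ nth (xs ++ ys) j) →
  (∀ {i j x} → nth (xs ++ ys) i ≡ just x → nth (xs ++ ys) j ≡ just x → BijRel m n π i j) →
  Unique xs × Unique ys × Relabels π xs ys
bijective-perfect-linking π xs ys refl sound perfect =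
  nth-injective⇒Unique xs (λ eᵢ eⱼ →
    BijRel-within-left (perfect (inˡ eᵢ) (inˡ eⱼ)) (nth-just⇒< xs eᵢ) (nth-just⇒< xs eⱼ)) ,
  nth-injective⇒Unique ys (λ eᵢ eⱼ →
    BijRel-within-right (perfect (trans (nth-++ʳ xs _) eᵢ) (trans (nth-++ʳ xs _) eⱼ))) ,
  relabels
  where
  open ≡-Reasoning
  inˡ : ∀ {i x} → nth xs i ≡ just x → nth (xs ++ ys) i ≡ just x
  inˡ e = trans (nth-++ˡ xs (nth-just⇒< xs e)) e
  relabels : Relabels π xs ys
  relabels k = begin
    nth ys (toℕ (π k))                       ≡⟨ nth-++ʳ xs _ ⟨
    nth (xs ++ ys) (length xs + toℕ (π k))   ≡⟨ sound (inj₂ (inj₁ (k , refl , refl))) ⟨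
    nth (xs ++ ys) (toℕ k)                   ≡⟨ nth-++ˡ xs (toℕ<n k) ⟩
    nth xs (toℕ k)                           ∎

relabel⇒same-set : ∀ {m n} (π : Fin m ↔ Fin n) {xs ys : List ℕ} → length xs ≡ m → length ys ≡ n →
                   Relabels (Inverse.to π) xs ys → xs ∼[ set ] ys
relabel⇒same-set π {xs} {ys} |xs| |ys| relabel = mk⇔ forth back
  where
  forth : x ∈ xs → x ∈ ys
  forth x∈ = let i , eᵢ = ∈⇒nth x∈ ; k , eₖ = nth-index xs |xs| eᵢ in nth⇒∈ ys (trans (relabel k) eₖ)
  back : x ∈ ys → x ∈ xs
  back x∈ = let j , eⱼ = ∈⇒nth x∈ ; k , eₖ = nth-index ys |ys| eⱼ in
    nth⇒∈ xs (trans (sym (relabel (Inverse.from π k)))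
                    (trans (cong (λ k′ → nth ys (toℕ k′)) (Inverse.strictlyInverseˡ π k)) eₖ))

map-relabel : ∀ {m n} (π : Fin m ↔ Fin n) (ρ : ℕ → ℕ) {xs ys xs′ ys′ : List ℕ} →
              length xs ≡ m → length xs′ ≡ m →
              Relabels (Inverse.to π) xs ys → Relabels (Inverse.from π) ys′ xs′ →
              map ρ ys′ ≡ ys → map ρ xs′ ≡ xs
map-relabel π ρ {xs} {ys} {xs′} {ys′} |xs| |xs′| relabel relabel′ ρys′ =
  nth-ext _ _ (trans (length-map ρ xs′) |xs′|) |xs| λ k → begin
    nth (map ρ xs′) (toℕ k)                ≡⟨ nth-map ρ xs′ (toℕ k) ⟩
    Maybe.map ρ (nth xs′ (toℕ k))          ≡⟨ cong (λ k′ → Maybe.map ρ (nth xs′ (toℕ k′))) (π⁻∘π⁺ k) ⟨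
    Maybe.map ρ (nth xs′ (toℕ (π⁻ (π⁺ k)))) ≡⟨ cong (Maybe.map ρ) (relabel′ (π⁺ k)) ⟩
    Maybe.map ρ (nth ys′ (toℕ (π⁺ k)))     ≡⟨ nth-map ρ ys′ _ ⟨
    nth (map ρ ys′) (toℕ (π⁺ k))           ≡⟨ cong (λ zs → nth zs (toℕ (π⁺ k))) ρys′ ⟩
    nth ys (toℕ (π⁺ k))                    ≡⟨ relabel k ⟩
    nth xs (toℕ k)                         ∎
  where
  open ≡-Reasoning
  open Inverse π using () renaming (to to π⁺; from to π⁻; strictlyInverseʳ to π⁻∘π⁺)

letters-subst : ∀ σ A → letters (subst σ A) ≡ map σ (letters A)
letters-subst σ (letter p) = refl
letters-subst σ (¬' A)     = letters-subst σ A
letters-subst σ (A ∧' B)   =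
  trans (cong₂ _++_ (letters-subst σ A) (letters-subst σ B)) (sym (map-++ σ (letters A) (letters B)))
letters-subst σ (A ∨' B)   =
  trans (cong₂ _++_ (letters-subst σ A) (letters-subst σ B)) (sym (map-++ σ (letters A) (letters B)))

∣subst∣ : ∀ σ A → ∣ subst σ A ∣ ≡ ∣ A ∣
∣subst∣ σ A = trans (cong length (letters-subst σ A)) (length-map σ (letters A))

data SameShape : Formula → Formula → Set where
  letter : SameShape (letter p) (letter q)
  ¬'_    : SameShape A B → SameShape (¬' A) (¬' B)
  _∧'_   : SameShape A B → SameShape C D → SameShape (A ∧' C) (B ∧' D)
  _∨'_   : SameShape A B → SameShape C D → SameShape (A ∨' C) (B ∨' D)

SameShape-subst : ∀ σ A → SameShape A (subst σ A)
SameShape-subst σ (letter p) = letter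
SameShape-subst σ (¬' A)     = ¬' SameShape-subst σ A
SameShape-subst σ (A ∧' B)   = SameShape-subst σ A ∧' SameShape-subst σ B
SameShape-subst σ (A ∨' B)   = SameShape-subst σ A ∨' SameShape-subst σ B

SameShape-sym : SameShape A B → SameShape B A
SameShape-sym letter    = letter
SameShape-sym (¬' s)    = ¬' SameShape-sym s
SameShape-sym (s ∧' t)  = SameShape-sym s ∧' SameShape-sym t
SameShape-sym (s ∨' t)  = SameShape-sym s ∨' SameShape-sym t

SameShape-trans : SameShape A B → SameShape B C → SameShape A C
SameShape-trans letter   letter   = letter
SameShape-trans (¬' s)   (¬' s′)  = ¬' SameShape-trans s s′
SameShape-trans (s ∧' t) (s′ ∧' t′) = SameShape-trans s s′ ∧' SameShape-trans t t′
SameShape-trans (s ∨' t) (s′ ∨' t′) = SameShape-trans s s′ ∨' SameShape-trans t t′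

common-instance⇒SameShape : ∀ σ τ → subst σ A ≡ subst τ B → SameShape A B
common-instance⇒SameShape {A} {B} σ τ eq =
  SameShape-trans (transport (SameShape A) eq (SameShape-subst σ A)) (SameShape-sym (SameShape-subst τ B))

length-++-cong : ∀ (xs xs′ : List ℕ) {ys ys′ : List ℕ} → length xs ≡ length xs′ → length ys ≡ length ys′ →
                 length (xs ++ ys) ≡ length (xs′ ++ ys′)
length-++-cong xs xs′ |xs| |ys| = trans (length-++ xs) (trans (cong₂ _+_ |xs| |ys|) (sym (length-++ xs′)))

SameShape-∣∣ : SameShape A B → ∣ A ∣ ≡ ∣ B ∣
SameShape-∣∣ letter = refl
SameShape-∣∣ (¬' s) = SameShape-∣∣ s
SameShape-∣∣ (_∧'_ {A} {B} s t) = length-++-cong (letters A) (letters B) (SameShape-∣∣ s) (SameShape-∣∣ t)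
SameShape-∣∣ (_∨'_ {A} {B} s t) = length-++-cong (letters A) (letters B) (SameShape-∣∣ s) (SameShape-∣∣ t)

++-injective : ∀ (xs xs′ : List ℕ) {ys ys′} → length xs ≡ length xs′ → xs ++ ys ≡ xs′ ++ ys′ →
               xs ≡ xs′ × ys ≡ ys′
++-injective []       []        _   eq = refl , eq
++-injective (x ∷ xs) (x′ ∷ xs′) len eq with ∷-injective eq
... | refl , eq′ = let xs≡ , ys≡ = ++-injective xs xs′ (suc-injective len) eq′ in cong (x ∷_) xs≡ , ys≡

split-letters : ∀ ρ A B {ys ys′} → SameShape A B → map ρ (letters A ++ ys) ≡ letters B ++ ys′ →
                map ρ (letters A) ≡ letters B × map ρ ys ≡ ys′
split-letters ρ A B s eq =
  ++-injective (map ρ (letters A)) (letters B) (trans (length-map ρ (letters A)) (SameShape-∣∣ s))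
               (trans (sym (map-++ ρ (letters A) _)) eq)

SameShape⇒subst : ∀ ρ → SameShape A B → map ρ (letters A) ≡ letters B → subst ρ A ≡ B
SameShape⇒subst ρ letter   eq = cong letter (∷-injectiveˡ eq)
SameShape⇒subst ρ (¬' s)   eq = cong ¬'_ (SameShape⇒subst ρ s eq)
SameShape⇒subst ρ (_∧'_ {A} {B} s t) eq with split-letters ρ A B s eq
... | eqˡ , eqʳ = cong₂ _∧'_ (SameShape⇒subst ρ s eqˡ) (SameShape⇒subst ρ t eqʳ)
SameShape⇒subst ρ (_∨'_ {A} {B} s t) eq with split-letters ρ A B s eq
... | eqˡ , eqʳ = cong₂ _∨'_ (SameShape⇒subst ρ s eqˡ) (SameShape⇒subst ρ t eqʳ)

-- From isomorphisms to derivations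

≡true-antisym : ∀ {x y} → (x ≡ true → y ≡ true) → (y ≡ true → x ≡ true) → x ≡ y
≡true-antisym {true}  {true}  _ _ = refl
≡true-antisym {true}  {false} f _ = sym (f refl)
≡true-antisym {false} {true}  _ g = g refl
≡true-antisym {false} {false} _ _ = refl

implications⇒≈ᵉ : ImpTautology A B → ImpTautology B A → A ≈ᵉ B
implications⇒≈ᵉ A⇒B B⇒A v = ≡true-antisym (A⇒B v) (B⇒A v)

ImpTautology-subst : ∀ ρ → ImpTautology A B → ImpTautology (subst ρ A) (subst ρ B)
ImpTautology-subst {A} {B} ρ A⇒B v t = trans (eval-subst ρ B) (A⇒B (v ∘ ρ) (trans (sym (eval-subst ρ A)) t))

length-instance : ∀ σ X → subst σ X ≡ A → length (letters X) ≡ ∣ A ∣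
length-instance σ X eq = trans (sym (∣subst∣ σ X)) (cong ∣_∣ eq)

-- B₂ is read-once, so a renaming ρ sends it letter by letter onto B₁, which has the same shape;
-- the relabellings by π and π⁻¹ force the same ρ to send A₂ onto A₁.
converse-by-renaming :
  (π : Fin ∣ A ∣ ↔ Fin ∣ B ∣) → ∀ σ τ →
  subst σ A₁ ≡ A → subst σ B₁ ≡ B → subst τ A₂ ≡ A → subst τ B₂ ≡ B → ReadOnce B₂ →
  Relabels (Inverse.to π) (letters A₁) (letters B₁) → Relabels (Inverse.from π) (letters B₂) (letters A₂) →
  ImpTautology B₂ A₂ → ImpTautology B₁ A₁
converse-by-renaming {A₁ = A₁} {B₁ = B₁} {A₂ = A₂} {B₂ = B₂}
                     π σ τ eA₁ eB₁ eA₂ eB₂ roB₂ relabel relabel′ B₂⇒A₂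
  with Unique⇒map-onto roB₂ (trans (length-instance τ B₂ eB₂) (sym (length-instance σ B₁ eB₁)))
... | ρ , ρB₂ =
  subst₂ ImpTautology (SameShape⇒subst ρ shapeB ρB₂) (SameShape⇒subst ρ shapeA ρA₂)
         (ImpTautology-subst {B₂} {A₂} ρ B₂⇒A₂)
  where
  shapeB : SameShape B₂ B₁
  shapeB = common-instance⇒SameShape τ σ (trans eB₂ (sym eB₁))
  shapeA : SameShape A₂ A₁
  shapeA = common-instance⇒SameShape τ σ (trans eA₂ (sym eA₁))
  ρA₂ : map ρ (letters A₂) ≡ letters A₁
  ρA₂ = map-relabel π ρ (length-instance σ A₁ eA₁) (length-instance τ A₂ eA₂) relabel relabel′ ρB₂

module _ {h e r} (K : KCategory h e r) where
  open KCategory K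

  perfect-generalization-linking :
    ∀ {A B A₁ B₁} (f : Hom A B) (f₁ : Hom A₁ B₁) (π : Fin ∣ A ∣ → Fin ∣ B ∣) →
    GeneralizedTo f f₁ → Perfect f₁ → L f ≐ BijRel ∣ A ∣ ∣ B ∣ π →
    ReadOnce A₁ × ReadOnce B₁ × Relabels π (letters A₁) (letters B₁)
  perfect-generalization-linking {A₁ = A₁} {B₁} f f₁ π ((σ , eA , _) , Lf≐Lf₁) perfect Lf≐ =
    bijective-perfect-linking π (letters A₁) (letters B₁) (length-instance σ A₁ eA) sound′ perfect′
    where
    in-range : ∀ {i x} → occ A₁ B₁ i ≡ just x → i < ∣ A₁ ∣ + ∣ B₁ ∣
    in-range e = transport (_ <_) (length-++ (letters A₁)) (nth-just⇒< (letters A₁ ++ letters B₁) e)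
    sound′ : ∀ {i j} → BijRel _ _ π i j → occ A₁ B₁ i ≡ occ A₁ B₁ j
    sound′ {i} {j} b = L-sound f₁ (proj₁ (Lf≐Lf₁ i j) (proj₂ (Lf≐ i j) b))
    perfect′ : ∀ {i j x} → occ A₁ B₁ i ≡ just x → occ A₁ B₁ j ≡ just x → BijRel _ _ π i j
    perfect′ {i} {j} eᵢ eⱼ =
      proj₁ (Lf≐ i j) (proj₂ (Lf≐Lf₁ i j) (perfect i j (in-range eᵢ) (in-range eⱼ) (trans eᵢ (sym eⱼ))))

  iso⇒S⊢ : Permutational K → PerfectlyGeneralizable K → Isomorphic A B → S⊢ A ↔ B
  iso⇒S⊢ perm general (f , g , g-inverse) with perm f g g-inverse | general f | general g
  ... | π , Lf≐ , Lg≐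
      | A₁ , B₁ , f₁ , f⊑f₁@((σ , refl , refl) , _) , perfect-f₁
      | B₂ , A₂ , g₁ , g⊑g₁@((τ , eB₂ , eA₂) , _) , perfect-g₁
    with perfect-generalization-linking f f₁ (Inverse.to π) f⊑f₁ perfect-f₁ Lf≐
       | perfect-generalization-linking g g₁ (Inverse.from π) g⊑g₁ perfect-g₁ Lg≐
  ... | roA₁ , roB₁ , relabel | roB₂ , _ , relabel′ = S⊢-subst σ (read-once-complete (record
    { read-onceˡ   = roA₁
    ; read-onceʳ   = roB₁
    ; same-letters = relabel⇒same-set π (length-instance σ A₁ refl) (length-instance σ B₁ refl) relabel
    ; equivalent   = implications⇒≈ᵉ {A₁} {B₁} (cond-ii f₁)
        (converse-by-renaming π σ τ refl refl eA₂ eB₂ roB₂ relabel relabel′ (cond-ii g₁))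
    }))

mainTheorem6 : ∀ {h e r : Level} (K : KCategory h e r) →
    Permutational K → PerfectlyGeneralizable K →
    (A B : Formula) → KCategory.Isomorphic K A B ⇔ (S⊢ A ↔ B)
mainTheorem6 K perm general A B = mk⇔ (iso⇒S⊢ K perm general) (KCategory.cond-i K)
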